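{- Let $q$ be an odd prime power and let $i$ be a non-square element of $\mathbb F_q^*$. Let $$H_i=\left\{\begin{pmatrix}x_1&x_2\\-x_2&x_4\end{pmatrix}\in M_2(\mathbb F_q): x_1x_4+x_2^2=i\right\},$$ and let $E$ be a maximal subset of $H_i$ with $E\cap(-E)=\emptyset$. Then $0\notin\det(E+E)$.
   Context: $M_2(\mathbb F_q)$ is the set of $2\times 2$ matrices over $\mathbb F_q$; $-E=\{ -e:e\in E\}$; $E+E=\{x+y:x,y\in E\}$; $\det(S)=\{\det(x):x\in S\}$. (Note $H_i\subseteq\{x:\det x=i\}$ and $|E|$ is of order $q^2$.) -}

module Defs where

open import Level using (0ℓ)
open import Algebra.Bundles using (CommutativeRing)
open import Data.Product using (Σ; ∃; _×_; _,_)
open import Data.Nat using (ℕ; _^_; _≤_)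
open import Data.Nat.Divisibility using (_∣_)
open import Data.Nat.Primality using (Prime)
open import Data.Fin using (Fin)
open import Data.Empty using (⊥)
open import Function.Bundles using (_↔_)
open import Relation.Nullary using (¬_)
open import Relation.Binary.PropositionalEquality using (_≡_)

record IsFieldRing (R : CommutativeRing 0ℓ 0ℓ) : Set where
  open CommutativeRing R
  field
    one≉zero : ¬ (1# ≈ 0#)
    inverse  : ∀ x → ¬ (x ≈ 0#) → ∃ λ y → x * y ≈ 1#

OddPrimePower : ℕ → Set
OddPrimePower q = Σ ℕ λ p → Σ ℕ λ k → Prime p × ¬ (2 ∣ p) × 1 ≤ k × q ≡ p ^ k

module M2 (R : CommutativeRing 0ℓ 0ℓ) where
  open CommutativeRing R

  record Mat : Set where
    constructor mat
    field
      a b c d : Carrier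
  open Mat public

  _+M_ : Mat → Mat → Mat
  x +M y = mat (a x + a y) (b x + b y) (c x + c y) (d x + d y)

  -M_ : Mat → Mat
  -M x = mat (- a x) (- b x) (- c x) (- d x)

  det : Mat → Carrier
  det x = a x * d x - b x * c x

  NonSquare : Carrier → Set
  NonSquare i = ¬ (i ≈ 0#) × (∀ y → ¬ (y * y ≈ i))

  Subset : Set₁
  Subset = Mat → Set

  _⊆_ : Subset → Subset → Set
  E ⊆ F = ∀ x → E x → F x

  H : Carrier → Subset
  H i x = (c x ≈ - b x) × (a x * d x + b x * b x ≈ i)

  negSet : Subset → Subset
  negSet E x = ∃ λ e → E e × x ≡ -M e

  DisjointFromNeg : Subset → Set
  DisjointFromNeg E = ∀ x → E x → negSet E x → ⊥

  MaximalAntipodalFree : Subset → Subset → Set₁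
  MaximalAntipodalFree S E =
    E ⊆ S × DisjointFromNeg E ×
    (∀ (E' : Subset) → E ⊆ E' → E' ⊆ S → DisjointFromNeg E' → E' ⊆ E)

  ZeroNotInDetSumset : Subset → Set
  ZeroNotInDetSumset E = ∀ x y → E x → E y → ¬ (det (x +M y) ≈ 0#)

-- For x, y ∈ H_i put z = x + y and Q(a, b, d) = a d + b², so that det = Q on matrices
-- of the shape (a b ; -b d). The polynomial identity
--   (x₁y₂ − x₂y₁)² + x₁y₁ Q(z) = z₁ (x₁ Q(y) + y₁ Q(x))
-- shows that det z = 0 forces z₁² i to be a square, hence z₁ = 0 because i is not one;
-- symmetrically z₄ = 0, and then z₂² = det z = 0. So y = −x, which E ∩ (−E) = ∅ forbids.
module Submission where

open import Defs
open import Level using (0ℓ)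
open import Algebra.Bundles using (CommutativeRing)
open import Data.Nat using (ℕ)
open import Data.Fin using (Fin)
open import Data.Product using (∃; _,_)
open import Function.Bundles using (_↔_)
open import Relation.Binary.PropositionalEquality as ≡ using (_≡_)
open import Relation.Nullary using (¬_)
import Algebra.Properties.AbelianGroup as AbelianGroupProperties
import Algebra.Properties.Group as GroupProperties
import Algebra.Properties.Ring as RingProperties
import Algebra.Solver.Ring.NaturalCoefficients.Default as SemiringSolver
import Relation.Binary.Reasoning.Setoid as SetoidReasoning

module CommutativeRingLemmas (R : CommutativeRing 0ℓ 0ℓ) where
  open CommutativeRing R
  open M2 R
  open GroupProperties +-group using (//-rightDividesˡ; ∙-cancelʳ; inverseʳ-unique; ⁻¹-involutive)
  open AbelianGroupProperties +-abelianGroup using (⁻¹-∙-comm)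
  open RingProperties ring using (-‿distribʳ-*)
  open SemiringSolver commutativeSemiring
  open SetoidReasoning setoid

  skewDet : Carrier → Carrier → Carrier → Carrier
  skewDet x₁ x₂ x₄ = x₁ * x₄ + x₂ * x₂

  skewDet-comm : ∀ x₁ x₂ x₄ → skewDet x₁ x₂ x₄ ≈ skewDet x₄ x₂ x₁
  skewDet-comm x₁ x₂ x₄ = +-congʳ (*-comm x₁ x₄)

  det-skew : ∀ x → c x ≈ - b x → det x ≈ skewDet (a x) (b x) (d x)
  det-skew (mat x₁ x₂ x₃ x₄) x₃≈-x₂ = +-congˡ (begin
    - (x₂ * x₃)      ≈⟨ -‿cong (*-congˡ x₃≈-x₂) ⟩
    - (x₂ * - x₂)    ≈⟨ -‿cong (-‿distribʳ-* x₂ x₂) ⟨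
    - (- (x₂ * x₂))  ≈⟨ ⁻¹-involutive (x₂ * x₂) ⟩
    x₂ * x₂          ∎)

  skew-+ : ∀ x y → c x ≈ - b x → c y ≈ - b y → c (x +M y) ≈ - b (x +M y)
  skew-+ x y cx≈-bx cy≈-by =
    trans (+-cong cx≈-bx cy≈-by) (⁻¹-∙-comm (b x) (b y))

  square-sub : ∀ u v → (u - v) * (u - v) + (u * v + u * v) ≈ u * u + v * v
  square-sub u v = begin
    w * w + (u * v + u * v)              ≈⟨ +-congˡ (+-cong uv≈[w+v]v uv≈[w+v]v) ⟩
    w * w + ((w + v) * v + (w + v) * v)  ≈⟨ solve 2 (λ w v → w :* w :+ ((w :+ v) :* v :+ (w :+ v) :* v)
                                                    := (w :+ v) :* (w :+ v) :+ v :* v) refl w v ⟩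
    (w + v) * (w + v) + v * v            ≈⟨ +-congʳ (*-cong u≈w+v u≈w+v) ⟨
    u * u + v * v                        ∎
    where
    w = u - v
    u≈w+v : u ≈ w + v
    u≈w+v = sym (//-rightDividesˡ v u)
    uv≈[w+v]v : u * v ≈ (w + v) * v
    uv≈[w+v]v = *-congʳ u≈w+v

  -- 2uv is added to both sides so that what remains is subtraction-free,
  -- hence within reach of the semiring solver.
  cross-square : ∀ x₁ x₂ x₄ y₁ y₂ y₄ →
    (x₁ * y₂ - x₂ * y₁) * (x₁ * y₂ - x₂ * y₁) + x₁ * y₁ * skewDet (x₁ + y₁) (x₂ + y₂) (x₄ + y₄)
      ≈ (x₁ + y₁) * (x₁ * skewDet y₁ y₂ y₄ + y₁ * skewDet x₁ x₂ x₄)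
  cross-square x₁ x₂ x₄ y₁ y₂ y₄ = ∙-cancelʳ (u * v + u * v) _ _ (begin
    t * t + s + (u * v + u * v)          ≈⟨ solve 3 (λ tt s uv → tt :+ s :+ uv := (tt :+ uv) :+ s)
                                                  refl (t * t) s (u * v + u * v) ⟩
    (t * t + (u * v + u * v)) + s        ≈⟨ +-congʳ (square-sub u v) ⟩
    (u * u + v * v) + s                  ≈⟨ solve 6 (λ x₁ x₂ x₄ y₁ y₂ y₄ →
      (x₁ :* y₂) :* (x₁ :* y₂) :+ (x₂ :* y₁) :* (x₂ :* y₁)
        :+ x₁ :* y₁ :* ((x₁ :+ y₁) :* (x₄ :+ y₄) :+ (x₂ :+ y₂) :* (x₂ :+ y₂))
      := (x₁ :+ y₁) :* (x₁ :* (y₁ :* y₄ :+ y₂ :* y₂) :+ y₁ :* (x₁ :* x₄ :+ x₂ :* x₂))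
        :+ ((x₁ :* y₂) :* (x₂ :* y₁) :+ (x₁ :* y₂) :* (x₂ :* y₁))) refl x₁ x₂ x₄ y₁ y₂ y₄ ⟩
    (x₁ + y₁) * (x₁ * skewDet y₁ y₂ y₄ + y₁ * skewDet x₁ x₂ x₄) + (u * v + u * v) ∎)
    where
    u = x₁ * y₂
    v = x₂ * y₁
    t = u - v
    s = x₁ * y₁ * skewDet (x₁ + y₁) (x₂ + y₂) (x₄ + y₄)

  singular-sum-scaled-square : ∀ {i} x₁ x₂ x₄ y₁ y₂ y₄ →
    skewDet x₁ x₂ x₄ ≈ i → skewDet y₁ y₂ y₄ ≈ i → skewDet (x₁ + y₁) (x₂ + y₂) (x₄ + y₄) ≈ 0# →
    (x₁ + y₁) * (x₁ + y₁) * i ≈ (x₁ * y₂ - x₂ * y₁) * (x₁ * y₂ - x₂ * y₁)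
  singular-sum-scaled-square {i} x₁ x₂ x₄ y₁ y₂ y₄ Qx≈i Qy≈i Qz≈0 = begin
    (x₁ + y₁) * (x₁ + y₁) * i             ≈⟨ solve 3 (λ x₁ y₁ i → (x₁ :+ y₁) :* (x₁ :+ y₁) :* i
                                                     := (x₁ :+ y₁) :* (x₁ :* i :+ y₁ :* i)) refl x₁ y₁ i ⟩
    (x₁ + y₁) * (x₁ * i + y₁ * i)         ≈⟨ *-congˡ (+-cong (*-congˡ Qy≈i) (*-congˡ Qx≈i)) ⟨
    (x₁ + y₁) * (x₁ * skewDet y₁ y₂ y₄ + y₁ * skewDet x₁ x₂ x₄)
                                          ≈⟨ cross-square x₁ x₂ x₄ y₁ y₂ y₄ ⟨
    t * t + x₁ * y₁ * skewDet (x₁ + y₁) (x₂ + y₂) (x₄ + y₄)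
                                          ≈⟨ +-congˡ (trans (*-congˡ Qz≈0) (zeroʳ (x₁ * y₁))) ⟩
    t * t + 0#                            ≈⟨ +-identityʳ (t * t) ⟩
    t * t                                 ∎
    where
    t = x₁ * y₂ - x₂ * y₁

  singular-with-zero-corner : ∀ z₁ z₂ z₄ → skewDet z₁ z₂ z₄ ≈ 0# → z₁ ≈ 0# → z₂ * z₂ ≈ 0#
  singular-with-zero-corner z₁ z₂ z₄ Qz≈0 z₁≈0 = begin
    z₂ * z₂            ≈⟨ +-identityˡ (z₂ * z₂) ⟨
    0# + z₂ * z₂       ≈⟨ +-congʳ (trans (*-congʳ z₁≈0) (zeroˡ z₄)) ⟨
    z₁ * z₄ + z₂ * z₂  ≈⟨ Qz≈0 ⟩
    0#                 ∎

  sum≈0⇒≡-M : (∀ {u v} → u ≈ v → u ≡ v) → ∀ x y → c x ≈ - b x → c y ≈ - b y →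
    a x + a y ≈ 0# → b x + b y ≈ 0# → d x + d y ≈ 0# → y ≡ -M x
  sum≈0⇒≡-M ≈⇒≡ (mat x₁ x₂ x₃ x₄) (mat y₁ y₂ y₃ y₄) x₃≈-x₂ y₃≈-y₂ a≈0 b≈0 d≈0
    with ≈⇒≡ (inverseʳ-unique x₁ y₁ a≈0) | ≈⇒≡ y₂≈-x₂ | ≈⇒≡ y₃≈-x₃ | ≈⇒≡ (inverseʳ-unique x₄ y₄ d≈0)
    where
    y₂≈-x₂ : y₂ ≈ - x₂
    y₂≈-x₂ = inverseʳ-unique x₂ y₂ b≈0
    y₃≈-x₃ : y₃ ≈ - x₃
    y₃≈-x₃ = begin
      y₃        ≈⟨ y₃≈-y₂ ⟩
      - y₂      ≈⟨ -‿cong y₂≈-x₂ ⟩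
      - (- x₂)  ≈⟨ -‿cong x₃≈-x₂ ⟨
      - x₃      ∎
  ... | ≡.refl | ≡.refl | ≡.refl | ≡.refl = ≡.refl

module FieldLemmas (R : CommutativeRing 0ℓ 0ℓ) (isField : IsFieldRing R) where
  open CommutativeRing R
  open IsFieldRing isField
  open SemiringSolver commutativeSemiring
  open SetoidReasoning setoid

  private
    square-of-product : ∀ u v → (u * v) * (u * v) ≈ (u * u) * (v * v)
    square-of-product = solve 2 (λ u v → (u :* v) :* (u :* v) := (u :* u) :* (v :* v)) refl

    inverse-square : ∀ {u v} → u * v ≈ 1# → (u * u) * (v * v) ≈ 1#
    inverse-square {u} {v} uv≈1 = begin
      (u * u) * (v * v)  ≈⟨ square-of-product u v ⟨
      (u * v) * (u * v)  ≈⟨ *-cong uv≈1 uv≈1 ⟩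
      1# * 1#            ≈⟨ *-identityˡ 1# ⟩
      1#                 ∎

  square≈0⇒¬¬≈0 : ∀ {u} → u * u ≈ 0# → ¬ ¬ u ≈ 0#
  square≈0⇒¬¬≈0 {u} uu≈0 u≉0 with inverse u u≉0
  ... | v , uv≈1 = one≉zero (begin
    1#                 ≈⟨ inverse-square uv≈1 ⟨
    (u * u) * (v * v)  ≈⟨ *-congʳ uu≈0 ⟩
    0# * (v * v)       ≈⟨ zeroˡ (v * v) ⟩
    0#                 ∎)

  scaled-square⇒square : ∀ {z t i} → ¬ z ≈ 0# → z * z * i ≈ t * t → ∃ λ w → w * w ≈ i
  scaled-square⇒square {z} {t} {i} z≉0 zzi≈tt with inverse z z≉0
  ... | v , zv≈1 = t * v , (begin
    (t * v) * (t * v)       ≈⟨ square-of-product t v ⟩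
    (t * t) * (v * v)       ≈⟨ *-congʳ zzi≈tt ⟨
    (z * z * i) * (v * v)   ≈⟨ solve 3 (λ z i v → (z :* z :* i) :* (v :* v) := i :* ((z :* z) :* (v :* v)))
                                     refl z i v ⟩
    i * ((z * z) * (v * v)) ≈⟨ *-congˡ (inverse-square zv≈1) ⟩
    i * 1#                  ≈⟨ *-identityʳ i ⟩
    i                       ∎)

module _ (R : CommutativeRing 0ℓ 0ℓ) (isField : IsFieldRing R)
         (≈⇒≡ : ∀ {u v : CommutativeRing.Carrier R} → CommutativeRing._≈_ R u v → u ≡ v) where
  open CommutativeRing R
  open M2 R
  open CommutativeRingLemmas R
  open FieldLemmas R isField

  -- The goal is negative, so the case splits on z₁ = 0 etc. are taken under double
  -- negation.
  H-singular-sum⇒¬¬antipodal : ∀ {i} x y → NonSquare i → H i x → H i y →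
    det (x +M y) ≈ 0# → ¬ ¬ (y ≡ -M x)
  H-singular-sum⇒¬¬antipodal {i} x@(mat x₁ x₂ x₃ x₄) y@(mat y₁ y₂ y₃ y₄)
    (_ , nonSquare) (x-skew , Qx≈i) (y-skew , Qy≈i) det≈0 y≢-x =
    ¬¬z₁≈0 λ z₁≈0 → ¬¬z₄≈0 λ z₄≈0 →
      square≈0⇒¬¬≈0 (singular-with-zero-corner z₁ z₂ z₄ Qz≈0 z₁≈0) λ z₂≈0 →
        y≢-x (sum≈0⇒≡-M ≈⇒≡ x y x-skew y-skew z₁≈0 z₂≈0 z₄≈0)
    where
    z₁ = x₁ + y₁
    z₂ = x₂ + y₂
    z₄ = x₄ + y₄
    Qz≈0 : skewDet z₁ z₂ z₄ ≈ 0#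
    Qz≈0 = trans (sym (det-skew (x +M y) (skew-+ x y x-skew y-skew))) det≈0
    ¬¬z₁≈0 : ¬ ¬ z₁ ≈ 0#
    ¬¬z₁≈0 z₁≉0 with scaled-square⇒square z₁≉0
                       (singular-sum-scaled-square x₁ x₂ x₄ y₁ y₂ y₄ Qx≈i Qy≈i Qz≈0)
    ... | w , ww≈i = nonSquare w ww≈i
    ¬¬z₄≈0 : ¬ ¬ z₄ ≈ 0#
    ¬¬z₄≈0 z₄≉0 with scaled-square⇒square z₄≉0
                       (singular-sum-scaled-square x₄ x₂ x₁ y₄ y₂ y₁
                          (trans (skewDet-comm x₄ x₂ x₁) Qx≈i) (trans (skewDet-comm y₄ y₂ y₁) Qy≈i)
                          (trans (skewDet-comm z₄ z₂ z₁) Qz≈0))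
    ... | w , ww≈i = nonSquare w ww≈i

corollary4p2 : (R : CommutativeRing 0ℓ 0ℓ) → IsFieldRing R →
    (∀ {x y : CommutativeRing.Carrier R} → CommutativeRing._≈_ R x y → x ≡ y) →
    (q : ℕ) → OddPrimePower q → CommutativeRing.Carrier R ↔ Fin q →
    (i : CommutativeRing.Carrier R) → M2.NonSquare R i →
    (E : M2.Subset R) → M2.MaximalAntipodalFree R (M2.H R i) E →
    M2.ZeroNotInDetSumset R E
corollary4p2 R isField ≈⇒≡ _ _ _ i nonSquare E (E⊆H , disjoint , _) x y x∈E y∈E det≈0 =
  H-singular-sum⇒¬¬antipodal R isField ≈⇒≡ x y nonSquare (E⊆H x x∈E) (E⊆H y y∈E) det≈0
    λ y≡-x → disjoint y y∈E (x , x∈E , y≡-x)
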